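{- Fix any logic $\mathcal{L}$. Let $c$ be a closed computation with $\vdash c : \mathtt{bool}\,!\,\emptyset/\emptyset$ and $v$ a closed value with $\vdash v:\mathtt{bool}$. If $[\![ \vdash c : \mathtt{bool}\,!\,\emptyset/\emptyset ]\!] = \mathrm{in}_{\mathrm{ret}}([\![ \vdash v : \mathtt{bool} ]\!])$, then $c \leadsto^* \mathtt{return}\ v$ (where $\leadsto^*$ is the reflexive-transitive closure of $\leadsto$).
   Context: Calculus. Values $v ::= x \mid () \mid \mathtt{true} \mid \mathtt{false} \mid \mathtt{fun}\,x\mapsto c \mid \mathtt{handler}\,\{\mathtt{return}\,x \mapsto c_r;\ h\}$; computations $c ::= \mathtt{if}\ v\ \mathtt{then}\ c_1\ \mathtt{else}\ c_2 \mid v_1\,v_2 \mid \mathtt{return}\ v \mid \mathit{op}(v; y.c) \mid \mathtt{do}\ x \leftarrow c_1\ \mathtt{in}\ c_2 \mid \mathtt{with}\ v\ \mathtt{handle}\ c$; operation clauses $h$ are finite sets of clauses $\mathit{op}(x;k)\mapsto c_{\mathit{op}}$, at most one per symbol. Value types $A,B ::= \mathtt{unit}\mid \mathtt{bool} \mid A \to \underline{C} \mid \underline{C}\Rightarrow \underline{D}$; computation types $\underline{C} ::= A\,!\,\Sigma/\mathcal{E}$, with $\Sigma$ a finite set of declarations $\mathit{op}: A_{\mathit{op}} \to B_{\mathit{op}}$ (distinct symbols) and $\mathcal{E}$ a finite set of equations $\Gamma; Z \vdash T_1 \sim T_2$ between templates $T ::= z\,v \mid \mathtt{if}\ v\ \mathtt{then}\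 T_1\ \mathtt{else}\ T_2 \mid \mathit{op}(v; y.T)$, where $Z=(z_j:B_j\to*)_j$. Typing (mutually defined, types well-formed: $A\,!\,\Sigma/\mathcal E$ requires both templates of each equation well-typed w.r.t. $\Sigma$). Values: variables from context; $()$ : unit; $\mathtt{true},\mathtt{false}$ : bool; $\mathtt{fun}\,x\mapsto c:A\to\underline C$ if $\Gamma,x:A\vdash c:\underline C$; $\mathtt{handler}\{\mathtt{return}\,x\mapsto c_r;h\}: A\,!\,\Sigma/\mathcal E\Rightarrow\underline D$ if $\Gamma,x:A\vdash c_r:\underline D$ and $\Gamma\vdash h\models\mathcal E:\Sigma\rightrightarrows\underline D$. Computations: $\mathtt{if}$ : $\underline C$ if guard bool and branches $\underline C$; $v_1\,v_2:\underline C$ if $v_1:A\to\underline C$, $v_2:A$; $\mathtt{return}\,v:A\,!\,\Sigma/\mathcal E$ if $v:A$; $\mathit{op}(v;y.c):A\,!\,\Sigma/\mathcal E$ if $(\mathit{op}:A_{op}\to B_{op})\in\Sigma$, $v:A_{op}$, $\Gamma,y:B_{op}\vdash c:A\,!\,\Sigma/\mathcal E$; $\mathtt{do}\,x\leftarrow c_1\,\mathtt{in}\,c_2:B\,!\,\Sigma/\mathcal E$ if $c_1:A\,!\,\Sigma/\mathcal E$, $\Gamma,x:A\vdash c_2:B\,!\,\Sigma/\mathcal E$; $\mathtt{with}\,v\,\mathtt{handle}\,c:\underline D$ if $v:\underline C\Rightarrow\underline D$, $c:\underline C$. Clauses: $\Gamma\vdash h:\Sigma\rightrightarrows\underline D$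 iff exactly one clause per operation of $\Sigma$ and no others, with $\Gamma,x:A_{op},k:B_{op}\to\underline D\vdash c_{op}:\underline D$. Templates: $z\,v$ if $(z:A\to*)\in Z$, $v:A$; conditionals; $\mathit{op}(v;y.T)$ if $(\mathit{op}:A\to B)\in\Sigma$, $v:A$, $T$ well-typed in $\Gamma,y:B;Z$. A logic is any choice of the judgment $\Gamma\vdash h\models\mathcal E:\Sigma\rightrightarrows\underline D$, holding only when $\Gamma\vdash h:\Sigma\rightrightarrows\underline D$. Small steps: $\mathtt{if}\,\mathtt{true}\,\mathtt{then}\,c_1\,\mathtt{else}\,c_2\leadsto c_1$, with $\mathtt{false}$ $\leadsto c_2$; $(\mathtt{fun}\,x\mapsto c)\,v\leadsto c[v/x]$; congruence in the first component of $\mathtt{do}$; $\mathtt{do}\,x\leftarrow\mathtt{return}\,v\,\mathtt{in}\,c\leadsto c[v/x]$; $\mathtt{do}\,x\leftarrow\mathit{op}(v;y.c_1)\,\mathtt{in}\,c_2\leadsto\mathit{op}(v;y.\mathtt{do}\,x\leftarrow c_1\,\mathtt{in}\,c_2)$; congruence in the handled computation; for $H=\mathtt{handler}\{\mathtt{return}\,x\mapsto c_r;h\}$: $\mathtt{with}\,H\,\mathtt{handle}\,\mathtt{return}\,v\leadsto c_r[v/x]$ and $\mathtt{with}\,H\,\mathtt{handle}\,\mathit{op}(v;y.c)\leadsto c_{op}[v/x,(\mathtt{fun}\,y\mapsto\mathtt{with}\,H\,\mathtt{handle}\,c)/k]$ if $(\mathit{op}(x;k)\mapsto c_{op})\in h$.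 Denotational semantics (ignores theories). $[\![\mathtt{unit}]\!]=\{\star\}$, $[\![\mathtt{bool}]\!]=\{\mathrm{ff},\mathrm{tt}\}$, $[\![A\to\underline C]\!]=[\![A]\!]\to[\![\underline C]\!]$, $[\![\underline C\Rightarrow\underline D]\!]=[\![\underline C]\!]\to[\![\underline D]\!]$, $[\![A\,!\,\Sigma/\mathcal E]\!]=[\![\Sigma]\!][\![A]\!]$, where $[\![\Sigma]\!]X$ is the inductive set generated by $\mathrm{in}_{\mathrm{ret}}(a)$ ($a\in X$) and $\mathrm{in}_{op}(a;\kappa)$ ($\mathit{op}\in\Sigma$, $a\in[\![A_{op}]\!]$, $\kappa:[\![B_{op}]\!]\to[\![\Sigma]\!]X$). An interpretation $H$ of $\Sigma$ over $Y$ is a family $H_{op}:[\![A_{op}]\!]\times([\![B_{op}]\!]\to Y)\to Y$; the free interpretation $F^X_\Sigma$ has $(F^X_\Sigma)_{op}(a,\kappa)=\mathrm{in}_{op}(a;\kappa)$; the lift of $f:X\to Y$ is $f^\dagger_H(\mathrm{in}_{\mathrm{ret}}(x))=f(x)$, $f^\dagger_H(\mathrm{in}_{op}(a;\kappa))=H_{op}(a,f^\dagger_H\circ\kappa)$. For $\eta\in[\![\Gamma]\!]$ (product of type denotations): variables are projections; constants as expected ($\mathtt{true}\mapsto\mathrm{tt}$, $\mathtt{false}\mapsto\mathrm{ff}$, $()\mapsto\star$); $[\![\mathtt{fun}\,x\mapsto c]\!]\eta=\lambda a.[\![c]\!](\eta,a)$; $([\![h]\!]\eta)_{op}(a,\kappa)=[\![c_{op}]\!](\eta,a,\kappa)$;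 $[\![\mathtt{handler}\{\mathtt{return}\,x\mapsto c_r;h\}]\!]\eta=(\lambda a.[\![c_r]\!](\eta,a))^\dagger_{[\![h]\!]\eta}$; $\mathtt{if}$ by cases; application is function application; $[\![\mathtt{return}\,v]\!]\eta=\mathrm{in}_{\mathrm{ret}}([\![v]\!]\eta)$; $[\![\mathit{op}(v;y.c)]\!]\eta=\mathrm{in}_{op}([\![v]\!]\eta;\lambda b.[\![c]\!](\eta,b))$; $[\![\mathtt{do}\,x\leftarrow c_1\,\mathtt{in}\,c_2]\!]\eta=(\lambda a.[\![c_2]\!](\eta,a))^\dagger_{F^{[\![A]\!]}_\Sigma}([\![c_1]\!]\eta)$; $[\![\mathtt{with}\,v\,\mathtt{handle}\,c]\!]\eta=[\![v]\!]\eta([\![c]\!]\eta)$. Closed terms are identified with elements. -}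

module Defs where

open import Data.Nat using (ℕ; zero; suc)
open import Data.Fin using (Fin; zero; suc)
open import Data.Bool using (Bool; true; false; if_then_else_)
open import Data.Unit using (⊤; tt)
open import Data.Product using (_×_; _,_; ∃; proj₁; proj₂)
open import Data.List using (List; []; _∷_; length; map)
open import Data.List.Membership.Propositional using (_∈_)
open import Data.List.Relation.Unary.Any using (here; there; index)
open import Data.List.Relation.Unary.All using (All; []; _∷_)
open import Data.List.Relation.Unary.Unique.Propositional using (Unique)
open import Relation.Binary.PropositionalEquality using (_≡_; refl; sym; subst)
open import Relation.Binary.Construct.Closure.ReflexiveTransitive using (Star)

-- Raw syntax (de Bruijn indices). Operation symbols are natural numbers.

OpSym : Set
OpSym = ℕ

mutual
  data Val : Set where
    var      : ℕ → Val
    unitV    : Val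
    trueV    : Val
    falseV   : Val
    funV     : Comp → Val                 -- fun x ↦ c       (c binds x = var 0)
    handlerV : Comp → Clauses → Val       -- handler {return x ↦ c_r ; h}  (c_r binds x)

  data Comp : Set where
    ifC     : Val → Comp → Comp → Comp
    appC    : Val → Val → Comp
    returnC : Val → Comp
    opC     : OpSym → Val → Comp → Comp   -- op(v ; y.c)     (c binds y)
    doC     : Comp → Comp → Comp          -- do x ← c₁ in c₂ (c₂ binds x)
    withC   : Val → Comp → Comp

  -- operation clauses  op(x ; k) ↦ c_op ; the body binds x = var 1, k = var 0
  data Clauses : Set where
    []   : Clauses
    cl   : OpSym → Comp → Clauses → Clauses

data _↦_∈h_ : OpSym → Comp → Clauses → Set where
  here  : ∀ {o c h} → o ↦ c ∈h cl o c h
  there : ∀ {o c o' c' h} → o ↦ c ∈h h → o ↦ c ∈h cl o' c' h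

syms : Clauses → List OpSym
syms []         = []
syms (cl o _ h) = o ∷ syms h

-- templates; z-variables are indices into Z
data Tmpl : Set where
  zT  : ℕ → Val → Tmpl
  ifT : Val → Tmpl → Tmpl → Tmpl
  opT : OpSym → Val → Tmpl → Tmpl       -- op(v ; y.T)   (T binds y)

mutual
  data VType : Set where
    unitT : VType
    boolT : VType
    _⇒_   : VType → CType → VType
    _⇛_   : CType → CType → VType

  data CType : Set where
    _!_/_ : VType → List (OpSym × VType × VType) → List Equation → CType

  -- Γ ; Z ⊢ T₁ ∼ T₂  with Z = (z_j : B_j → *)_j  given as the list of B_j
  data Equation : Set where
    eqn : List VType → List VType → Tmpl → Tmpl → Equation

Sig : Set
Sig = List (OpSym × VType × VType)

Ctx : Set
Ctx = List VType

data _∋_⦂_ : Ctx → ℕ → VType → Set where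
  here  : ∀ {Γ A} → (A ∷ Γ) ∋ zero ⦂ A
  there : ∀ {Γ A B n} → Γ ∋ n ⦂ A → (B ∷ Γ) ∋ suc n ⦂ A

-- A logic: any choice of a judgment  Γ ⊢ h ⊨ E : Σ ⇉ D.  The requirement
-- that it holds only when Γ ⊢ h : Σ ⇉ D is built into the handler rule,
-- which demands both the clause typing and the logic judgment.
Logic : Set₁
Logic = Ctx → Clauses → List Equation → Sig → CType → Set

mutual
  data _∣_⊢v_⦂_ (L : Logic) : Ctx → Val → VType → Set where
    tvar     : ∀ {Γ n A} → Γ ∋ n ⦂ A → L ∣ Γ ⊢v var n ⦂ A
    tunit    : ∀ {Γ} → L ∣ Γ ⊢v unitV ⦂ unitT
    ttrue    : ∀ {Γ} → L ∣ Γ ⊢v trueV ⦂ boolT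
    tfalse   : ∀ {Γ} → L ∣ Γ ⊢v falseV ⦂ boolT
    tfun     : ∀ {Γ A C c} → L ∣ (A ∷ Γ) ⊢c c ⦂ C → L ∣ Γ ⊢v funV c ⦂ (A ⇒ C)
    thandler : ∀ {Γ A Sg E D cr h} →
               L ∣ (A ∷ Γ) ⊢c cr ⦂ D →
               L ∣ Γ ⊢h h ⦂ Sg ⇉ D →
               L Γ h E Sg D →
               L ∣ Γ ⊢v handlerV cr h ⦂ ((A ! Sg / E) ⇛ D)

  data _∣_⊢c_⦂_ (L : Logic) : Ctx → Comp → CType → Set where
    tif     : ∀ {Γ v c₁ c₂ C} → L ∣ Γ ⊢v v ⦂ boolT →
              L ∣ Γ ⊢c c₁ ⦂ C → L ∣ Γ ⊢c c₂ ⦂ C → L ∣ Γ ⊢c ifC v c₁ c₂ ⦂ C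
    tapp    : ∀ {Γ v₁ v₂ A C} → WFV L A →
              L ∣ Γ ⊢v v₁ ⦂ (A ⇒ C) → L ∣ Γ ⊢v v₂ ⦂ A → L ∣ Γ ⊢c appC v₁ v₂ ⦂ C
    treturn : ∀ {Γ v A Sg E} → L ∣ Γ ⊢v v ⦂ A → L ∣ Γ ⊢c returnC v ⦂ (A ! Sg / E)
    top     : ∀ {Γ o v c A Sg E Aop Bop} → (o , Aop , Bop) ∈ Sg →
              L ∣ Γ ⊢v v ⦂ Aop → L ∣ (Bop ∷ Γ) ⊢c c ⦂ (A ! Sg / E) →
              L ∣ Γ ⊢c opC o v c ⦂ (A ! Sg / E)
    tdo     : ∀ {Γ c₁ c₂ A B Sg E} → WFV L A →
              L ∣ Γ ⊢c c₁ ⦂ (A ! Sg / E) → L ∣ (A ∷ Γ) ⊢c c₂ ⦂ (B ! Sg / E) →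
              L ∣ Γ ⊢c doC c₁ c₂ ⦂ (B ! Sg / E)
    twith   : ∀ {Γ v c C D} → WFC L C →
              L ∣ Γ ⊢v v ⦂ (C ⇛ D) → L ∣ Γ ⊢c c ⦂ C → L ∣ Γ ⊢c withC v c ⦂ D

  data _∣_⊢h_⦂_⇉_ (L : Logic) (Γ : Ctx) (h : Clauses) (Sg : Sig) (D : CType) : Set where
    tclauses : All (λ t → ∃ λ c → (proj₁ t ↦ c ∈h h)
                          × (L ∣ ((proj₂ (proj₂ t) ⇒ D) ∷ proj₁ (proj₂ t) ∷ Γ) ⊢c c ⦂ D)) Sg →
               All (λ o → o ∈ map proj₁ Sg) (syms h) →
               Unique (syms h) →
               L ∣ Γ ⊢h h ⦂ Sg ⇉ D

  data _∣_∣_∣_⊢t_ (L : Logic) (Sg : Sig) : Ctx → Ctx → Tmpl → Set where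
    tzT  : ∀ {Γ Z j v B} → Z ∋ j ⦂ B → L ∣ Γ ⊢v v ⦂ B → L ∣ Sg ∣ Γ ∣ Z ⊢t zT j v
    tifT : ∀ {Γ Z v T₁ T₂} → L ∣ Γ ⊢v v ⦂ boolT →
           L ∣ Sg ∣ Γ ∣ Z ⊢t T₁ → L ∣ Sg ∣ Γ ∣ Z ⊢t T₂ → L ∣ Sg ∣ Γ ∣ Z ⊢t ifT v T₁ T₂
    topT : ∀ {Γ Z o v T A B} → (o , A , B) ∈ Sg → L ∣ Γ ⊢v v ⦂ A →
           L ∣ Sg ∣ (B ∷ Γ) ∣ Z ⊢t T → L ∣ Sg ∣ Γ ∣ Z ⊢t opT o v T

  data WFV (L : Logic) : VType → Set where
    wunit : WFV L unitT
    wbool : WFV L boolT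
    warr  : ∀ {A C} → WFV L A → WFC L C → WFV L (A ⇒ C)
    whnd  : ∀ {C D} → WFC L C → WFC L D → WFV L (C ⇛ D)

  data WFC (L : Logic) : CType → Set where
    wcomp : ∀ {A Sg E} → WFV L A →
            All (λ t → WFV L (proj₁ (proj₂ t)) × WFV L (proj₂ (proj₂ t))) Sg →
            Unique (map proj₁ Sg) →
            All (WFEq L Sg) E →
            WFC L (A ! Sg / E)

  data WFEq (L : Logic) (Sg : Sig) : Equation → Set where
    weq : ∀ {Γ Z T₁ T₂} → All (WFV L) Γ → All (WFV L) Z →
          L ∣ Sg ∣ Γ ∣ Z ⊢t T₁ → L ∣ Sg ∣ Γ ∣ Z ⊢t T₂ →
          WFEq L Sg (eqn Γ Z T₁ T₂)

wk : ℕ → ℕ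
wk n = suc n

ext : (ℕ → ℕ) → ℕ → ℕ
ext ρ zero    = zero
ext ρ (suc n) = suc (ρ n)

mutual
  renV : (ℕ → ℕ) → Val → Val
  renV ρ (var n)        = var (ρ n)
  renV ρ unitV          = unitV
  renV ρ trueV          = trueV
  renV ρ falseV         = falseV
  renV ρ (funV c)       = funV (renC (ext ρ) c)
  renV ρ (handlerV c h) = handlerV (renC (ext ρ) c) (renH ρ h)

  renC : (ℕ → ℕ) → Comp → Comp
  renC ρ (ifC v c₁ c₂) = ifC (renV ρ v) (renC ρ c₁) (renC ρ c₂)
  renC ρ (appC v₁ v₂)  = appC (renV ρ v₁) (renV ρ v₂)
  renC ρ (returnC v)   = returnC (renV ρ v)
  renC ρ (opC o v c)   = opC o (renV ρ v) (renC (ext ρ) c)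
  renC ρ (doC c₁ c₂)   = doC (renC ρ c₁) (renC (ext ρ) c₂)
  renC ρ (withC v c)   = withC (renV ρ v) (renC ρ c)

  renH : (ℕ → ℕ) → Clauses → Clauses
  renH ρ []         = []
  renH ρ (cl o c h) = cl o (renC (ext (ext ρ)) c) (renH ρ h)

exts : (ℕ → Val) → ℕ → Val
exts σ zero    = var zero
exts σ (suc n) = renV wk (σ n)

mutual
  subV : (ℕ → Val) → Val → Val
  subV σ (var n)        = σ n
  subV σ unitV          = unitV
  subV σ trueV          = trueV
  subV σ falseV         = falseV
  subV σ (funV c)       = funV (subC (exts σ) c)
  subV σ (handlerV c h) = handlerV (subC (exts σ) c) (subH σ h)

  subC : (ℕ → Val) → Comp → Comp
  subC σ (ifC v c₁ c₂) = ifC (subV σ v) (subC σ c₁) (subC σ c₂)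
  subC σ (appC v₁ v₂)  = appC (subV σ v₁) (subV σ v₂)
  subC σ (returnC v)   = returnC (subV σ v)
  subC σ (opC o v c)   = opC o (subV σ v) (subC (exts σ) c)
  subC σ (doC c₁ c₂)   = doC (subC σ c₁) (subC (exts σ) c₂)
  subC σ (withC v c)   = withC (subV σ v) (subC σ c)

  subH : (ℕ → Val) → Clauses → Clauses
  subH σ []         = []
  subH σ (cl o c h) = cl o (subC (exts (exts σ)) c) (subH σ h)

sub1 : Val → ℕ → Val
sub1 v zero    = v
sub1 v (suc n) = var n

_[_] : Comp → Val → Comp
c [ v ] = subC (sub1 v) c

sub2 : Val → Val → ℕ → Val
sub2 v f zero          = f
sub2 v f (suc zero)    = v
sub2 v f (suc (suc n)) = var n

infix 4 _⇝_
data _⇝_ : Comp → Comp → Set where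
  if-true   : ∀ {c₁ c₂} → ifC trueV c₁ c₂ ⇝ c₁
  if-false  : ∀ {c₁ c₂} → ifC falseV c₁ c₂ ⇝ c₂
  beta      : ∀ {c v} → appC (funV c) v ⇝ c [ v ]
  do-cong   : ∀ {c₁ c₁' c₂} → c₁ ⇝ c₁' → doC c₁ c₂ ⇝ doC c₁' c₂
  do-return : ∀ {v c} → doC (returnC v) c ⇝ c [ v ]
  -- c₂ is weakened past the new binder y
  do-op     : ∀ {o v c₁ c₂} → doC (opC o v c₁) c₂ ⇝ opC o v (doC c₁ (renC (ext wk) c₂))
  with-cong : ∀ {v c c'} → c ⇝ c' → withC v c ⇝ withC v c'
  with-return : ∀ {cr h v} → withC (handlerV cr h) (returnC v) ⇝ cr [ v ]
  with-op   : ∀ {cr h o v c cop} → o ↦ cop ∈h h →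
              withC (handlerV cr h) (opC o v c)
                ⇝ subC (sub2 v (funV (withC (renV wk (handlerV cr h)) c))) cop

_⇝*_ : Comp → Comp → Set
_⇝*_ = Star _⇝_

data Free (I : Set) (Ar Co : I → Set) (X : Set) : Set where
  in-ret : X → Free I Ar Co X
  in-op  : (i : I) → Ar i → (Co i → Free I Ar Co X) → Free I Ar Co X

lift : ∀ {I : Set} {Ar Co : I → Set} {X Y : Set} → (X → Y) → ((i : I) → Ar i → (Co i → Y) → Y) →
       Free I Ar Co X → Y
lift f H (in-ret x)     = f x
lift f H (in-op i a κ)  = H i a (λ b → lift f H (κ b))

mutual
  ⟦_⟧v : VType → Set
  ⟦ unitT ⟧v = ⊤
  ⟦ boolT ⟧v = Bool
  ⟦ A ⇒ C ⟧v = ⟦ A ⟧v → ⟦ C ⟧c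
  ⟦ C ⇛ D ⟧v = ⟦ C ⟧c → ⟦ D ⟧c

  ⟦_⟧c : CType → Set
  ⟦ A ! Sg / E ⟧c = Free (Fin (length Sg)) (ArgS Sg) (ResS Sg) ⟦ A ⟧v

  ArgS : (Sg : Sig) → Fin (length Sg) → Set
  ArgS ((o , A , B) ∷ Sg) zero    = ⟦ A ⟧v
  ArgS ((o , A , B) ∷ Sg) (suc i) = ArgS Sg i

  ResS : (Sg : Sig) → Fin (length Sg) → Set
  ResS ((o , A , B) ∷ Sg) zero    = ⟦ B ⟧v
  ResS ((o , A , B) ∷ Sg) (suc i) = ResS Sg i

argEq : ∀ {Sg o A B} (p : (o , A , B) ∈ Sg) → ArgS Sg (index p) ≡ ⟦ A ⟧v
argEq (here refl) = refl
argEq (there p)   = argEq p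

resEq : ∀ {Sg o A B} (p : (o , A , B) ∈ Sg) → ResS Sg (index p) ≡ ⟦ B ⟧v
resEq (here refl) = refl
resEq (there p)   = resEq p

Env : Ctx → Set
Env Γ = All ⟦_⟧v Γ

lookupEnv : ∀ {Γ n A} → Γ ∋ n ⦂ A → Env Γ → ⟦ A ⟧v
lookupEnv here      (a ∷ η) = a
lookupEnv (there x) (a ∷ η) = lookupEnv x η

cast : ∀ {X Y : Set} → X ≡ Y → X → Y
cast refl x = x

mutual
  ⟦_⟧V : ∀ {L Γ v A} → L ∣ Γ ⊢v v ⦂ A → Env Γ → ⟦ A ⟧v
  ⟦ tvar x ⟧V η          = lookupEnv x η
  ⟦ tunit ⟧V η           = tt
  ⟦ ttrue ⟧V η           = true
  ⟦ tfalse ⟧V η          = false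
  ⟦ tfun d ⟧V η          = λ a → ⟦ d ⟧C (a ∷ η)
  ⟦ thandler dr dh _ ⟧V η = lift (λ a → ⟦ dr ⟧C (a ∷ η)) (⟦ dh ⟧H η)

  ⟦_⟧C : ∀ {L Γ c C} → L ∣ Γ ⊢c c ⦂ C → Env Γ → ⟦ C ⟧c
  ⟦ tif dv d₁ d₂ ⟧C η  = if ⟦ dv ⟧V η then ⟦ d₁ ⟧C η else ⟦ d₂ ⟧C η
  ⟦ tapp _ d₁ d₂ ⟧C η  = ⟦ d₁ ⟧V η (⟦ d₂ ⟧V η)
  ⟦ treturn dv ⟧C η    = in-ret (⟦ dv ⟧V η)
  ⟦ top p dv dc ⟧C η   = in-op (index p) (cast (sym (argEq p)) (⟦ dv ⟧V η))
                                 (λ b → ⟦ dc ⟧C (cast (resEq p) b ∷ η))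
  ⟦ tdo _ d₁ d₂ ⟧C η   = lift (λ a → ⟦ d₂ ⟧C (a ∷ η)) in-op (⟦ d₁ ⟧C η)
  ⟦ twith _ dv dc ⟧C η = ⟦ dv ⟧V η (⟦ dc ⟧C η)

  ⟦_⟧H : ∀ {L Γ h Sg D} → L ∣ Γ ⊢h h ⦂ Sg ⇉ D → Env Γ →
         (i : Fin (length Sg)) → ArgS Sg i → (ResS Sg i → ⟦ D ⟧c) → ⟦ D ⟧c
  ⟦ tclauses ds _ _ ⟧H η = interp ds η

  interp : ∀ {L Γ h Sg D} →
           All (λ t → ∃ λ c → (proj₁ t ↦ c ∈h h)
                     × (L ∣ ((proj₂ (proj₂ t) ⇒ D) ∷ proj₁ (proj₂ t) ∷ Γ) ⊢c c ⦂ D)) Sg →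
           Env Γ → (i : Fin (length Sg)) → ArgS Sg i → (ResS Sg i → ⟦ D ⟧c) → ⟦ D ⟧c
  interp ((c , m , d) ∷ ds) η zero    a κ = ⟦ d ⟧C (κ ∷ a ∷ η)
  interp (_ ∷ ds)           η (suc i) a κ = interp ds η i a κ

-- Adequacy by a logical relation between denotations and closed terms. At unit
-- and bool a value is related to the constant it denotes; at function and handler
-- types related arguments must give related results. A computation of type
-- A ! Σ / E is related to a tree of [Σ]⟦A⟧ when it reduces to return of a related
-- value (for a leaf) or to an operation call with related argument and related
-- continuations (for a node). The fundamental lemma, by induction on typing derivations with an
-- inner induction on trees for handlers, relates every closed well-typed term to
-- its denotation, and at type bool ! ∅ / ∅ being related to in-ret b means
-- reducing to return of the constant b.
module Submission where

open import Defs
open import Data.List using ([])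
open import Data.List.Relation.Unary.All using ([])
open import Relation.Binary.PropositionalEquality using (_≡_)

open import Data.Bool using (Bool; true; false; if_then_else_)
open import Data.Fin using (Fin; zero; suc)
open import Data.List using (_∷_; length)
open import Data.List.Membership.Propositional using (_∈_)
open import Data.List.Relation.Unary.All using (All; _∷_)
open import Data.List.Relation.Unary.Any using (here; there; index)
open import Data.Nat using (ℕ; zero; suc)
open import Data.Product using (Σ-syntax; ∃; _×_; _,_)
open import Function using (_∘_)
open import Relation.Binary.PropositionalEquality
  using (refl; sym; trans; cong; cong₂; subst; _≗_)
open import Relation.Binary.Construct.Closure.ReflexiveTransitive
  using (ε; _◅_; _◅◅_; gmap)

cong₃ : ∀ {A B C D : Set} (f : A → B → C → D) {a a' b b' c c'} →
        a ≡ a' → b ≡ b' → c ≡ c' → f a b c ≡ f a' b' c'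
cong₃ f refl refl refl = refl

-- Substitution algebra

ext-ext : ∀ {ρ ρ' ρ''} → ρ ∘ ρ' ≗ ρ'' → ext ρ ∘ ext ρ' ≗ ext ρ''
ext-ext h zero    = refl
ext-ext h (suc n) = cong suc (h n)

mutual
  renV-renV : ∀ {ρ ρ' ρ''} → ρ ∘ ρ' ≗ ρ'' → ∀ v → renV ρ (renV ρ' v) ≡ renV ρ'' v
  renV-renV h (var n)        = cong var (h n)
  renV-renV h unitV          = refl
  renV-renV h trueV          = refl
  renV-renV h falseV         = refl
  renV-renV h (funV c)       = cong funV (renC-renC (ext-ext h) c)
  renV-renV h (handlerV c k) = cong₂ handlerV (renC-renC (ext-ext h) c) (renH-renH h k)

  renC-renC : ∀ {ρ ρ' ρ''} → ρ ∘ ρ' ≗ ρ'' → ∀ c → renC ρ (renC ρ' c) ≡ renC ρ'' c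
  renC-renC h (ifC v c₁ c₂) = cong₃ ifC (renV-renV h v) (renC-renC h c₁) (renC-renC h c₂)
  renC-renC h (appC v₁ v₂)  = cong₂ appC (renV-renV h v₁) (renV-renV h v₂)
  renC-renC h (returnC v)   = cong returnC (renV-renV h v)
  renC-renC h (opC o v c)   = cong₂ (opC o) (renV-renV h v) (renC-renC (ext-ext h) c)
  renC-renC h (doC c₁ c₂)   = cong₂ doC (renC-renC h c₁) (renC-renC (ext-ext h) c₂)
  renC-renC h (withC v c)   = cong₂ withC (renV-renV h v) (renC-renC h c)

  renH-renH : ∀ {ρ ρ' ρ''} → ρ ∘ ρ' ≗ ρ'' → ∀ k → renH ρ (renH ρ' k) ≡ renH ρ'' k
  renH-renH h []         = refl
  renH-renH h (cl o c k) = cong₂ (cl o) (renC-renC (ext-ext (ext-ext h)) c) (renH-renH h k)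

renV-exts : ∀ {ρ σ σ'} → renV ρ ∘ σ ≗ σ' → renV (ext ρ) ∘ exts σ ≗ exts σ'
renV-exts h zero    = refl
renV-exts {σ = σ} h (suc n) =
  trans (renV-renV (λ _ → refl) (σ n))
        (trans (sym (renV-renV (λ _ → refl) (σ n))) (cong (renV wk) (h n)))

mutual
  renV-subV : ∀ {ρ σ σ'} → renV ρ ∘ σ ≗ σ' → ∀ v → renV ρ (subV σ v) ≡ subV σ' v
  renV-subV h (var n)        = h n
  renV-subV h unitV          = refl
  renV-subV h trueV          = refl
  renV-subV h falseV         = refl
  renV-subV h (funV c)       = cong funV (renC-subC (renV-exts h) c)
  renV-subV h (handlerV c k) = cong₂ handlerV (renC-subC (renV-exts h) c) (renH-subH h k)

  renC-subC : ∀ {ρ σ σ'} → renV ρ ∘ σ ≗ σ' → ∀ c → renC ρ (subC σ c) ≡ subC σ' c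
  renC-subC h (ifC v c₁ c₂) = cong₃ ifC (renV-subV h v) (renC-subC h c₁) (renC-subC h c₂)
  renC-subC h (appC v₁ v₂)  = cong₂ appC (renV-subV h v₁) (renV-subV h v₂)
  renC-subC h (returnC v)   = cong returnC (renV-subV h v)
  renC-subC h (opC o v c)   = cong₂ (opC o) (renV-subV h v) (renC-subC (renV-exts h) c)
  renC-subC h (doC c₁ c₂)   = cong₂ doC (renC-subC h c₁) (renC-subC (renV-exts h) c₂)
  renC-subC h (withC v c)   = cong₂ withC (renV-subV h v) (renC-subC h c)

  renH-subH : ∀ {ρ σ σ'} → renV ρ ∘ σ ≗ σ' → ∀ k → renH ρ (subH σ k) ≡ subH σ' k
  renH-subH h []         = refl
  renH-subH h (cl o c k) =
    cong₂ (cl o) (renC-subC (renV-exts (renV-exts h)) c) (renH-subH h k)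

exts-ext : ∀ {σ ρ σ'} → σ ∘ ρ ≗ σ' → exts σ ∘ ext ρ ≗ exts σ'
exts-ext h zero    = refl
exts-ext h (suc n) = cong (renV wk) (h n)

mutual
  subV-renV : ∀ {σ ρ σ'} → σ ∘ ρ ≗ σ' → ∀ v → subV σ (renV ρ v) ≡ subV σ' v
  subV-renV h (var n)        = h n
  subV-renV h unitV          = refl
  subV-renV h trueV          = refl
  subV-renV h falseV         = refl
  subV-renV h (funV c)       = cong funV (subC-renC (exts-ext h) c)
  subV-renV h (handlerV c k) = cong₂ handlerV (subC-renC (exts-ext h) c) (subH-renH h k)

  subC-renC : ∀ {σ ρ σ'} → σ ∘ ρ ≗ σ' → ∀ c → subC σ (renC ρ c) ≡ subC σ' c
  subC-renC h (ifC v c₁ c₂) = cong₃ ifC (subV-renV h v) (subC-renC h c₁) (subC-renC h c₂)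
  subC-renC h (appC v₁ v₂)  = cong₂ appC (subV-renV h v₁) (subV-renV h v₂)
  subC-renC h (returnC v)   = cong returnC (subV-renV h v)
  subC-renC h (opC o v c)   = cong₂ (opC o) (subV-renV h v) (subC-renC (exts-ext h) c)
  subC-renC h (doC c₁ c₂)   = cong₂ doC (subC-renC h c₁) (subC-renC (exts-ext h) c₂)
  subC-renC h (withC v c)   = cong₂ withC (subV-renV h v) (subC-renC h c)

  subH-renH : ∀ {σ ρ σ'} → σ ∘ ρ ≗ σ' → ∀ k → subH σ (renH ρ k) ≡ subH σ' k
  subH-renH h []         = refl
  subH-renH h (cl o c k) =
    cong₂ (cl o) (subC-renC (exts-ext (exts-ext h)) c) (subH-renH h k)

subV-exts : ∀ {τ σ σ'} → subV τ ∘ σ ≗ σ' → subV (exts τ) ∘ exts σ ≗ exts σ'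
subV-exts h zero    = refl
subV-exts {σ = σ} h (suc n) =
  trans (subV-renV (λ _ → refl) (σ n))
        (trans (sym (renV-subV (λ _ → refl) (σ n))) (cong (renV wk) (h n)))

mutual
  subV-subV : ∀ {τ σ σ'} → subV τ ∘ σ ≗ σ' → ∀ v → subV τ (subV σ v) ≡ subV σ' v
  subV-subV h (var n)        = h n
  subV-subV h unitV          = refl
  subV-subV h trueV          = refl
  subV-subV h falseV         = refl
  subV-subV h (funV c)       = cong funV (subC-subC (subV-exts h) c)
  subV-subV h (handlerV c k) = cong₂ handlerV (subC-subC (subV-exts h) c) (subH-subH h k)

  subC-subC : ∀ {τ σ σ'} → subV τ ∘ σ ≗ σ' → ∀ c → subC τ (subC σ c) ≡ subC σ' c
  subC-subC h (ifC v c₁ c₂) = cong₃ ifC (subV-subV h v) (subC-subC h c₁) (subC-subC h c₂)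
  subC-subC h (appC v₁ v₂)  = cong₂ appC (subV-subV h v₁) (subV-subV h v₂)
  subC-subC h (returnC v)   = cong returnC (subV-subV h v)
  subC-subC h (opC o v c)   = cong₂ (opC o) (subV-subV h v) (subC-subC (subV-exts h) c)
  subC-subC h (doC c₁ c₂)   = cong₂ doC (subC-subC h c₁) (subC-subC (subV-exts h) c₂)
  subC-subC h (withC v c)   = cong₂ withC (subV-subV h v) (subC-subC h c)

  subH-subH : ∀ {τ σ σ'} → subV τ ∘ σ ≗ σ' → ∀ k → subH τ (subH σ k) ≡ subH σ' k
  subH-subH h []         = refl
  subH-subH h (cl o c k) =
    cong₂ (cl o) (subC-subC (subV-exts (subV-exts h)) c) (subH-subH h k)

exts-id : ∀ {σ} → σ ≗ var → exts σ ≗ var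
exts-id h zero    = refl
exts-id h (suc n) = cong (renV wk) (h n)

mutual
  subV-id : ∀ {σ} → σ ≗ var → ∀ v → subV σ v ≡ v
  subV-id h (var n)        = h n
  subV-id h unitV          = refl
  subV-id h trueV          = refl
  subV-id h falseV         = refl
  subV-id h (funV c)       = cong funV (subC-id (exts-id h) c)
  subV-id h (handlerV c k) = cong₂ handlerV (subC-id (exts-id h) c) (subH-id h k)

  subC-id : ∀ {σ} → σ ≗ var → ∀ c → subC σ c ≡ c
  subC-id h (ifC v c₁ c₂) = cong₃ ifC (subV-id h v) (subC-id h c₁) (subC-id h c₂)
  subC-id h (appC v₁ v₂)  = cong₂ appC (subV-id h v₁) (subV-id h v₂)
  subC-id h (returnC v)   = cong returnC (subV-id h v)
  subC-id h (opC o v c)   = cong₂ (opC o) (subV-id h v) (subC-id (exts-id h) c)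
  subC-id h (doC c₁ c₂)   = cong₂ doC (subC-id h c₁) (subC-id (exts-id h) c₂)
  subC-id h (withC v c)   = cong₂ withC (subV-id h v) (subC-id h c)

  subH-id : ∀ {σ} → σ ≗ var → ∀ k → subH σ k ≡ k
  subH-id h []         = refl
  subH-id h (cl o c k) = cong₂ (cl o) (subC-id (exts-id (exts-id h)) c) (subH-id h k)

infixl 5 _▸_

_▸_ : (ℕ → Val) → Val → ℕ → Val
(σ ▸ w) zero    = w
(σ ▸ w) (suc n) = σ n

sub1-wkV : ∀ w v → subV (sub1 w) (renV wk v) ≡ v
sub1-wkV w v = trans (subV-renV (λ _ → refl) v) (subV-id (λ _ → refl) v)

sub2-wkV : ∀ w f v → subV (sub2 w f) (renV wk (renV wk v)) ≡ v
sub2-wkV w f v =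
  trans (subV-renV (λ _ → refl) (renV wk v))
        (trans (subV-renV (λ _ → refl) v) (subV-id (λ _ → refl) v))

subC-exts-sub1 : ∀ σ w c → subC (exts σ) c [ w ] ≡ subC (σ ▸ w) c
subC-exts-sub1 σ w = subC-subC exts-sub1
  where
  exts-sub1 : subV (sub1 w) ∘ exts σ ≗ σ ▸ w
  exts-sub1 zero    = refl
  exts-sub1 (suc n) = sub1-wkV w (σ n)

subC-exts²-sub2 : ∀ σ w f c → subC (sub2 w f) (subC (exts (exts σ)) c) ≡ subC (σ ▸ w ▸ f) c
subC-exts²-sub2 σ w f = subC-subC exts²-sub2
  where
  exts²-sub2 : subV (sub2 w f) ∘ exts (exts σ) ≗ σ ▸ w ▸ f
  exts²-sub2 zero          = refl
  exts²-sub2 (suc zero)    = refl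
  exts²-sub2 (suc (suc n)) = sub2-wkV w f (σ n)

-- The continuation of do, weakened past the binder of an operation call by the
-- do-op rule, is restored when that binder is substituted for.
subC-exts-sub1-ext-wk : ∀ u c → subC (exts (sub1 u)) (renC (ext wk) c) ≡ c
subC-exts-sub1-ext-wk u c = trans (subC-renC cancel c) (subC-id (λ _ → refl) c)
  where
  cancel : exts (sub1 u) ∘ ext wk ≗ var
  cancel zero    = refl
  cancel (suc n) = refl

∈h-subH : ∀ σ {o c h} → o ↦ c ∈h h → o ↦ subC (exts (exts σ)) c ∈h subH σ h
∈h-subH σ here      = here
∈h-subH σ (there m) = there (∈h-subH σ m)

with-cong* : ∀ {v c c'} → c ⇝* c' → withC v c ⇝* withC v c'
with-cong* = gmap _ with-cong

do-cong* : ∀ {c₂ c c'} → c ⇝* c' → doC c c₂ ⇝* doC c' c₂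
do-cong* = gmap _ do-cong

-- Logical relation

⟦_⟧Σ : Sig → Set → Set
⟦ Sg ⟧Σ = Free (Fin (length Sg)) (ArgS Sg) (ResS Sg)

opname : (Sg : Sig) → Fin (length Sg) → OpSym
opname ((o , _) ∷ Sg) zero    = o
opname (_ ∷ Sg)       (suc i) = opname Sg i

mutual
  RelV : (A : VType) → ⟦ A ⟧v → Val → Set
  RelV unitT   _ v = v ≡ unitV
  RelV boolT   b v = v ≡ (if b then trueV else falseV)
  RelV (A ⇒ C) f v = ∀ a w → RelV A a w → RelC C (f a) (appC v w)
  RelV (C ⇛ D) g v = ∀ m c → RelC C m c → RelC D (g m) (withC v c)

  RelC : (C : CType) → ⟦ C ⟧c → Comp → Set
  RelC (A ! Sg / _) = RelF A Sg

  RelF : (A : VType) (Sg : Sig) → ⟦ Sg ⟧Σ ⟦ A ⟧v → Comp → Set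
  RelF A Sg (in-ret a) c = Σ[ w ∈ Val ] (c ⇝* returnC w) × RelV A a w
  RelF A Sg (in-op i a κ) c = Σ[ w ∈ Val ] Σ[ c' ∈ Comp ]
    (c ⇝* opC (opname Sg i) w c') × RelArg Sg i a w ×
    (∀ b u → RelRes Sg i b u → RelF A Sg (κ b) (c' [ u ]))

  RelArg : (Sg : Sig) (i : Fin (length Sg)) → ArgS Sg i → Val → Set
  RelArg ((_ , A , _) ∷ Sg) zero    = RelV A
  RelArg (_ ∷ Sg)           (suc i) = RelArg Sg i

  RelRes : (Sg : Sig) (i : Fin (length Sg)) → ResS Sg i → Val → Set
  RelRes ((_ , _ , B) ∷ Sg) zero    = RelV B
  RelRes (_ ∷ Sg)           (suc i) = RelRes Sg i

opname-index : ∀ {Sg o A B} (p : (o , A , B) ∈ Sg) → opname Sg (index p) ≡ o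
opname-index (here refl) = refl
opname-index (there p)   = opname-index p

RelArg-index : ∀ {Sg o A B} (p : (o , A , B) ∈ Sg) {a w} →
               RelV A a w → RelArg Sg (index p) (cast (sym (argEq p)) a) w
RelArg-index (here refl) r = r
RelArg-index (there p)   r = RelArg-index p r

RelRes-index : ∀ {Sg o A B} (p : (o , A , B) ∈ Sg) {b u} →
               RelRes Sg (index p) b u → RelV B (cast (resEq p) b) u
RelRes-index (here refl) r = r
RelRes-index (there p)   r = RelRes-index p r

RelF-expand : ∀ A Sg m {c c'} → c ⇝* c' → RelF A Sg m c' → RelF A Sg m c
RelF-expand A Sg (in-ret a)    s (w , s' , r)          = w , s ◅◅ s' , r
RelF-expand A Sg (in-op i a κ) s (w , c'' , s' , r , k) = w , c'' , s ◅◅ s' , r , k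

RelC-expand : ∀ C m {c c'} → c ⇝* c' → RelC C m c' → RelC C m c
RelC-expand (A ! Sg / _) = RelF-expand A Sg

RelEnv : (Γ : Ctx) → Env Γ → (ℕ → Val) → Set
RelEnv Γ η σ = ∀ {n A} (x : Γ ∋ n ⦂ A) → RelV A (lookupEnv x η) (σ n)

RelEnv-▸ : ∀ {Γ A η σ a w} → RelEnv Γ η σ → RelV A a w → RelEnv (A ∷ Γ) (a ∷ η) (σ ▸ w)
RelEnv-▸ ρ r here      = r
RelEnv-▸ ρ r (there x) = ρ x

RelC-if : ∀ C {m₁ m₂ c₁ c₂ v} (b : Bool) → v ≡ (if b then trueV else falseV) →
          RelC C m₁ c₁ → RelC C m₂ c₂ → RelC C (if b then m₁ else m₂) (ifC v c₁ c₂)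
RelC-if C {m₁}      true  refl r₁ r₂ = RelC-expand C m₁ (if-true ◅ ε) r₁
RelC-if C {m₂ = m₂} false refl r₁ r₂ = RelC-expand C m₂ (if-false ◅ ε) r₂

RelF-do : ∀ {A B Sg} {g : ⟦ A ⟧v → ⟦ Sg ⟧Σ ⟦ B ⟧v} {c₂} m {c} → RelF A Sg m c →
          (∀ a w → RelV A a w → RelF B Sg (g a) (c₂ [ w ])) →
          RelF B Sg (lift g in-op m) (doC c c₂)
RelF-do {B = B} {Sg} {g} (in-ret a) (w , s , r) k =
  RelF-expand B Sg (g a) (do-cong* s ◅◅ (do-return ◅ ε)) (k a w r)
RelF-do {B = B} {Sg} {g} {c₂} (in-op i a κ) (w , c' , s , ra , k') k =
  w , doC c' (renC (ext wk) c₂) , do-cong* s ◅◅ (do-op ◅ ε) , ra ,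
  λ b u r → subst (λ x → RelF B Sg (lift g in-op (κ b)) (doC (c' [ u ]) x))
                  (sym (subC-exts-sub1-ext-wk u c₂))
                  (RelF-do (κ b) (k' b u r) k)

ClauseTyped : Logic → Ctx → Clauses → CType → OpSym × VType × VType → Set
ClauseTyped L Γ h D (o , A , B) = ∃ λ c → (o ↦ c ∈h h) × (L ∣ ((B ⇒ D) ∷ A ∷ Γ) ⊢c c ⦂ D)

-- Fundamental lemma

mutual
  fundamentalV : ∀ {L Γ v A} (d : L ∣ Γ ⊢v v ⦂ A) {η σ} → RelEnv Γ η σ →
                 RelV A (⟦ d ⟧V η) (subV σ v)
  fundamentalV (tvar x)           ρ = ρ x
  fundamentalV tunit              ρ = refl
  fundamentalV ttrue              ρ = refl
  fundamentalV tfalse             ρ = refl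
  fundamentalV (tfun {C = C} d)   ρ a w r =
    RelC-expand C _ (beta ◅ ε) (fundamentalC-bind d ρ r)
  fundamentalV (thandler dr (tclauses ds _ _) _) ρ m c = RelF-handle dr ds ρ m

  fundamentalC : ∀ {L Γ c C} (d : L ∣ Γ ⊢c c ⦂ C) {η σ} → RelEnv Γ η σ →
                 RelC C (⟦ d ⟧C η) (subC σ c)
  fundamentalC (tif {C = C} dv d₁ d₂) {η} ρ =
    RelC-if C (⟦ dv ⟧V η) (fundamentalV dv ρ) (fundamentalC d₁ ρ) (fundamentalC d₂ ρ)
  fundamentalC (tapp _ d₁ d₂) ρ = fundamentalV d₁ ρ _ _ (fundamentalV d₂ ρ)
  fundamentalC (treturn dv)   ρ = _ , ε , fundamentalV dv ρ
  fundamentalC (top {o = o} p dv dc) ρ =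
    _ , _ , subst (λ o' → opC o _ _ ⇝* opC o' _ _) (sym (opname-index p)) ε ,
    RelArg-index p (fundamentalV dv ρ) ,
    λ b u r → fundamentalC-bind dc ρ (RelRes-index p r)
  fundamentalC (tdo _ d₁ d₂) ρ =
    RelF-do _ (fundamentalC d₁ ρ) λ a w r → fundamentalC-bind d₂ ρ r
  fundamentalC (twith _ dv dc) ρ = fundamentalV dv ρ _ _ (fundamentalC dc ρ)

  fundamentalC-bind : ∀ {L Γ A c C} (d : L ∣ (A ∷ Γ) ⊢c c ⦂ C) {η σ a w} →
                      RelEnv Γ η σ → RelV A a w →
                      RelC C (⟦ d ⟧C (a ∷ η)) (subC (exts σ) c [ w ])
  fundamentalC-bind {c = c} {C} d {σ = σ} {w = w} ρ r =
    subst (RelC C _) (sym (subC-exts-sub1 σ w c)) (fundamentalC d (RelEnv-▸ ρ r))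

  RelF-handle : ∀ {L Γ A Sg D cr h} (dr : L ∣ (A ∷ Γ) ⊢c cr ⦂ D)
                (ds : All (ClauseTyped L Γ h D) Sg) {η σ} → RelEnv Γ η σ →
                (m : ⟦ Sg ⟧Σ ⟦ A ⟧v) → ∀ {c} → RelF A Sg m c →
                RelC D (lift (λ a → ⟦ dr ⟧C (a ∷ η)) (interp ds η) m)
                       (withC (subV σ (handlerV cr h)) c)
  RelF-handle {D = D} dr ds ρ (in-ret a) (w , s , r) =
    RelC-expand D _ (with-cong* s ◅◅ (with-return ◅ ε)) (fundamentalC-bind dr ρ r)
  RelF-handle {A = A} {Sg} {D} {cr} {h} dr ds {η} {σ} ρ (in-op i a κ)
              (w , c' , s , ra , k) =
    let cop , cop∈h , related = RelC-clause ds ρ i ra continuation-related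
    in RelC-expand D _ (with-cong* s ◅◅ (with-op (∈h-subH σ cop∈h) ◅ ε)) related
    where
    handler : Val
    handler = subV σ (handlerV cr h)

    handled : ⟦ Sg ⟧Σ ⟦ A ⟧v → ⟦ D ⟧c
    handled = lift (λ a → ⟦ dr ⟧C (a ∷ η)) (interp ds η)

    continuation-related : ∀ b u → RelRes Sg i b u →
                           RelC D (handled (κ b)) (appC (funV (withC (renV wk handler) c')) u)
    continuation-related b u r =
      RelC-expand D _ (beta ◅ ε)
        (subst (λ x → RelC D (handled (κ b)) (withC x (c' [ u ]))) (sym (sub1-wkV u handler))
               (RelF-handle dr ds ρ (κ b) (k b u r)))

  RelC-clause : ∀ {L Γ h Sg D} (ds : All (ClauseTyped L Γ h D) Sg) {η σ} → RelEnv Γ η σ →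
                (i : Fin (length Sg)) → ∀ {a w} → RelArg Sg i a w →
                {κ : ResS Sg i → ⟦ D ⟧c} {f : Val} →
                (∀ b u → RelRes Sg i b u → RelC D (κ b) (appC f u)) →
                ∃ λ cop → (opname Sg i ↦ cop ∈h h) ×
                  RelC D (interp ds η i a κ) (subC (sub2 w f) (subC (exts (exts σ)) cop))
  RelC-clause {D = D} ((cop , cop∈h , d) ∷ _) {σ = σ} ρ zero {w = w} ra {f = f} rκ =
    cop , cop∈h ,
    subst (RelC D _) (sym (subC-exts²-sub2 σ w f cop))
          (fundamentalC d (RelEnv-▸ (RelEnv-▸ ρ ra) rκ))
  RelC-clause (_ ∷ ds) ρ (suc i) ra rκ = RelC-clause ds ρ i ra rκ

RelEnv-[] : RelEnv [] [] var
RelEnv-[] ()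

fundamental-closedV : ∀ {L v A} (d : L ∣ [] ⊢v v ⦂ A) → RelV A (⟦ d ⟧V []) v
fundamental-closedV {v = v} {A} d =
  subst (RelV A _) (subV-id (λ _ → refl) v) (fundamentalV d RelEnv-[])

fundamental-closedC : ∀ {L c C} (d : L ∣ [] ⊢c c ⦂ C) → RelC C (⟦ d ⟧C []) c
fundamental-closedC {c = c} {C} d =
  subst (RelC C _) (subC-id (λ _ → refl) c) (fundamentalC d RelEnv-[])

lemma2 : (L : Logic) (c : Comp) (v : Val)
         (dc : L ∣ [] ⊢c c ⦂ (boolT ! [] / [])) (dv : L ∣ [] ⊢v v ⦂ boolT) →
         ⟦ dc ⟧C [] ≡ in-ret (⟦ dv ⟧V []) →
         c ⇝* returnC v
lemma2 L c v dc dv ⟦c⟧≡ret⟦v⟧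
  with subst (λ m → RelC (boolT ! [] / []) m c) ⟦c⟧≡ret⟦v⟧ (fundamental-closedC dc)
... | w , c⇝*w , w≡⟦v⟧ =
  subst (λ u → c ⇝* returnC u) (trans w≡⟦v⟧ (sym (fundamental-closedV dv))) c⇝*w
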